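{- Let $n \geq 1$. The set of linear extensions of the de Finetti lattice $F_{n,2}$ is in bijection with the set of shifted standard Young tableaux of staircase shape $(n, n-1, \ldots, 1)$. Consequently, the number of linear extensions of $F_{n,2}$ equals the number of such tableaux, i.e. the $n$-th strict-sense ballot number.
   Context: Let $[n]=\{1,\ldots,n\}$. The ground set of $F_{n,2}$ consists of $\emptyset$ and all subsets of $[n]$ of size $1$ or $2$. Identify each nonempty such set $S$ with the pair $(a,b)$, where $a=\max S$ and $b$ is the other element of $S$ if $|S|=2$ and $b=0$ if $|S|=1$ (so $\{i\}\leftrightarrow (i,0)$ and $\{i,j\}\leftrightarrow(j,i)$ for $i<j$). The partial order $\preceq$ of $F_{n,2}$ is: $\emptyset$ is the minimum element, and $(a,b)\preceq(c,d)$ iff $a\le c$ and $b\le d$. (Equivalently, $F_{n,2}$ is the poset on subsets of size at most 2 generated by set inclusion, $\{i\}\prec\{k\}$ iff $i<k$, and, for $i<j$, $k<\ell$: $\{i,j\}\prec\{k,\ell\}$ iff ($i<k$ and $j\le \ell$) or ($i\le k$ and $j<\ell$).) A linear extension of a poset is a total order on the same ground set containing the poset's order relation. A shifted standard Young tableau of shape $(n,n-1,\ldots,1)$ is a bijective filling of the cells $\{(r,c): 1\le r\le c\le n\}$ with the integers $1,2,\ldots,n(n+1)/2$ such that entries increase along each row (increasing $c$) and down each column (increasing $r$). The number of such tableaux is known as the $n$-th strict-sense ballot number. -}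

module Defs where

open import Level using (0ℓ)
open import Data.Nat using (ℕ; zero; suc; _+_)
open import Data.Fin using (Fin; toℕ) renaming (_<_ to _<ᶠ_)
open import Data.Product using (Σ; Σ-syntax; _×_; proj₁)
open import Data.Unit using (⊤)
open import Data.Empty using (⊥)
import Data.Nat as ℕ
open import Function.Definitions using (Bijective)
open import Relation.Binary.PropositionalEquality using (_≡_; _≢_; refl; sym; trans)
open import Relation.Binary.Bundles using (Setoid)
open import Relation.Nullary using (¬_)

tri : ℕ → ℕ
tri zero = 0
tri (suc n) = suc n + tri n

-- The de Finetti lattice F_{n,2}
-- Ground set: ∅ together with pairs (a , b), 1 ≤ a ≤ n, 0 ≤ b < a.
-- 'pt a b' encodes the pair (toℕ a + 1 , toℕ b); so a : Fin n ranges over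
-- 1..n and b : Fin (toℕ a + 1) ranges over 0..a-1.
-- {i} ↔ (i,0) and {i,j} ↔ (j,i) for i<j.

data F2 (n : ℕ) : Set where
  ∅  : F2 n
  pt : (a : Fin n) → (b : Fin (suc (toℕ a))) → F2 n

_⪯_ : {n : ℕ} → F2 n → F2 n → Set
∅ ⪯ y = ⊤
pt a b ⪯ ∅ = ⊥
pt a b ⪯ pt c d = (toℕ a ℕ.≤ toℕ c) × (toℕ b ℕ.≤ toℕ d)

_≺_ : {n : ℕ} → F2 n → F2 n → Set
x ≺ y = (x ⪯ y) × (x ≢ y)

-- The ground set has 1 + n(n+1)/2 elements.  A linear extension (total
-- order on the ground set containing ⪯) is encoded by its position map:
-- a bijection from the ground set to the positions {0,…,n(n+1)/2}
-- such that x ≺ y implies x comes strictly before y.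
record LinExt (n : ℕ) : Set where
  field
    pos       : F2 n → Fin (suc (tri n))
    bijective : Bijective _≡_ _≡_ pos
    extends   : ∀ {x y} → x ≺ y → pos x <ᶠ pos y

LinExtSetoid : ℕ → Setoid 0ℓ 0ℓ
LinExtSetoid n = record
  { Carrier = LinExt n
  ; _≈_ = λ L M → ∀ x → LinExt.pos L x ≡ LinExt.pos M x
  ; isEquivalence = record
    { refl = λ x → refl
    ; sym = λ p x → sym (p x)
    ; trans = λ p q x → trans (p x) (q x)
    }
  }

-- Shifted standard Young tableaux of staircase shape (n, n-1, …, 1)
-- Cells (r , c) with 1 ≤ r ≤ c ≤ n.  'cell c r' encodes the cell
-- (toℕ r + 1 , toℕ c + 1), with c : Fin n and r : Fin (toℕ c + 1).

data Cell (n : ℕ) : Set where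
  cell : (c : Fin n) → (r : Fin (suc (toℕ c))) → Cell n

row : {n : ℕ} → Cell n → ℕ
row (cell c r) = toℕ r

col : {n : ℕ} → Cell n → ℕ
col (cell c r) = toℕ c

-- A filling with 1, …, n(n+1)/2 is encoded (shifted by one) as a bijection
-- from the cells to Fin (n(n+1)/2), i.e. the values 0, …, n(n+1)/2 - 1.
record ShiftedSYT (n : ℕ) : Set where
  field
    entry     : Cell n → Fin (tri n)
    bijective : Bijective _≡_ _≡_ entry
    rowIncr   : ∀ x y → row x ≡ row y → col x ℕ.< col y → entry x <ᶠ entry y
    colIncr   : ∀ x y → col x ≡ col y → row x ℕ.< row y → entry x <ᶠ entry y

ShiftedSYTSetoid : ℕ → Setoid 0ℓ 0ℓ
ShiftedSYTSetoid n = record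
  { Carrier = ShiftedSYT n
  ; _≈_ = λ S T → ∀ x → ShiftedSYT.entry S x ≡ ShiftedSYT.entry T x
  ; isEquivalence = record
    { refl = λ x → refl
    ; sym = λ p x → sym (p x)
    ; trans = λ p q x → trans (p x) (q x)
    }
  }

{-# OPTIONS --safe #-}
module Submission where

-- The bottom element ∅ occupies position 0 of every linear extension, and
-- removing it leaves the pairs (a , b), b < a, ordered componentwise; under
-- (a , b) ↦ (column a , row b) this is exactly the order on the cells of the
-- shifted staircase generated by rows and columns.  A filling is strictly
-- monotone for the componentwise order iff it increases along rows and
-- columns, because a componentwise step from (a , b) to (c , d) with a < c
-- factors as a row step to the cell (c , b) followed by a column step.

open import Defs
open import Data.Nat using (ℕ; _≥_; zero; suc; z≤n; s≤s)
import Data.Nat as ℕ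
import Data.Nat.Properties as ℕ
open import Data.Fin using (Fin; zero; suc; toℕ; fromℕ<; punchOut) renaming (_<_ to _<ᶠ_; _≤_ to _≤ᶠ_)
open import Data.Fin.Properties
  using (toℕ-injective; toℕ-fromℕ<; toℕ<n; suc-injective; punchOut-cong; punchOut-injective; punchOut-mono-≤; punchIn-punchOut)
open import Data.Product using (∃; _,_; proj₁; proj₂)
open import Data.Sum using (inj₁; inj₂)
open import Data.Unit using (tt)
open import Data.Empty using (⊥-elim)
open import Function using (_∘_)
open import Function.Bundles using (Inverse)
open import Relation.Binary.PropositionalEquality

punchOut-mono-< : ∀ {m} {i j k : Fin (suc m)} (i≢j : i ≢ j) (i≢k : i ≢ k) →
                  j <ᶠ k → punchOut i≢j <ᶠ punchOut i≢k
punchOut-mono-< i≢j i≢k j<k =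
  ℕ.≤∧≢⇒< (punchOut-mono-≤ i≢j i≢k (ℕ.<⇒≤ j<k))
          (λ eq → ℕ.<⇒≢ j<k (cong toℕ (punchOut-injective i≢j i≢k (toℕ-injective eq))))

point : ∀ {n} → Cell n → F2 n
point (cell c r) = pt c r

point-injective : ∀ {n} {x y : Cell n} → point x ≡ point y → x ≡ y
point-injective {x = cell c r} {cell c r} refl = refl

cell-≡ : ∀ {n} {x y : Cell n} → col x ≡ col y → row x ≡ row y → x ≡ y
cell-≡ {x = cell c r} {cell c′ r′} c≡c′ r≡r′ with toℕ-injective c≡c′
... | refl with toℕ-injective r≡r′
... | refl = refl

row-step-≺ : ∀ {n} {x y : Cell n} → row x ≡ row y → col x ℕ.< col y → point x ≺ point y
row-step-≺ {x = cell c r} {cell c′ r′} r≡r′ c<c′ =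
  (ℕ.<⇒≤ c<c′ , ℕ.≤-reflexive r≡r′) , λ eq → ℕ.<⇒≢ c<c′ (cong col (point-injective eq))

column-step-≺ : ∀ {n} {x y : Cell n} → col x ≡ col y → row x ℕ.< row y → point x ≺ point y
column-step-≺ {x = cell c r} {cell c′ r′} c≡c′ r<r′ =
  (ℕ.≤-reflexive c≡c′ , ℕ.<⇒≤ r<r′) , λ eq → ℕ.<⇒≢ r<r′ (cong row (point-injective eq))

module FromLinExt {n} (L : LinExt n) where
  open LinExt L

  ∅≺pt : ∀ (a : Fin n) b → ∅ ≺ pt a b
  ∅≺pt a b = tt , λ ()

  pos-∅ : pos ∅ ≡ zero
  pos-∅ with proj₂ bijective zero
  ... | ∅ , pos≡0 = pos≡0 refl
  ... | pt a b , pos≡0 =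
    ⊥-elim (ℕ.n≮0 (ℕ.<-≤-trans (extends (∅≺pt a b)) (ℕ.≤-reflexive (cong toℕ (pos≡0 refl)))))

  zero≢pos : ∀ x → zero ≢ pos (point x)
  zero≢pos (cell c r) eq = ℕ.<⇒≢ (extends (∅≺pt c r)) (cong toℕ (trans pos-∅ eq))

  entry : Cell n → Fin (tri n)
  entry x = punchOut (zero≢pos x)

  entry-mono : ∀ {x y} → point x ≺ point y → entry x <ᶠ entry y
  entry-mono {x} {y} x≺y = punchOut-mono-< (zero≢pos x) (zero≢pos y) (extends x≺y)

  entry-injective : ∀ {x y} → entry x ≡ entry y → x ≡ y
  entry-injective {x} {y} eq =
    point-injective (proj₁ bijective (punchOut-injective (zero≢pos x) (zero≢pos y) eq))

  entry-surjective : ∀ i → ∃ λ x → ∀ {z} → z ≡ x → entry z ≡ i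
  entry-surjective i with proj₂ bijective (suc i)
  ... | ∅ , pos≡ with trans (sym pos-∅) (pos≡ refl)
  ... | ()
  entry-surjective i | pt a b , pos≡ = cell a b , λ { refl → punchOut-cong zero {i≢k = λ ()} (pos≡ refl) }

  shiftedSYT : ShiftedSYT n
  shiftedSYT = record
    { entry     = entry
    ; bijective = entry-injective , entry-surjective
    ; rowIncr   = λ x y r≡ c< → entry-mono (row-step-≺ {x = x} {y} r≡ c<)
    ; colIncr   = λ x y c≡ r< → entry-mono (column-step-≺ {x = x} {y} c≡ r<)
    }

module FromShiftedSYT {n} (S : ShiftedSYT n) where
  open ShiftedSYT S

  entry-column-≤ : ∀ x y → col x ≡ col y → row x ℕ.≤ row y → entry x ≤ᶠ entry y
  entry-column-≤ x y c≡ r≤ with ℕ.m≤n⇒m<n∨m≡n r≤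
  ... | inj₁ r< = ℕ.<⇒≤ (colIncr x y c≡ r<)
  ... | inj₂ r≡ = ℕ.≤-reflexive (cong (toℕ ∘ entry) (cell-≡ c≡ r≡))

  entry-mono : ∀ {x y} → point x ≺ point y → entry x <ᶠ entry y
  entry-mono {cell a b} {cell c d} ((a≤c , b≤d) , ≢) with ℕ.m≤n⇒m<n∨m≡n a≤c
  ... | inj₁ a<c = ℕ.<-≤-trans (rowIncr (cell a b) corner (sym (toℕ-fromℕ< b<1+c)) a<c)
                               (entry-column-≤ corner (cell c d) refl
                                  (ℕ.≤-trans (ℕ.≤-reflexive (toℕ-fromℕ< b<1+c)) b≤d))
    where
      b<1+c : toℕ b ℕ.< suc (toℕ c)
      b<1+c = s≤s (ℕ.≤-trans (ℕ.≤-pred (toℕ<n b)) (ℕ.<⇒≤ a<c))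
      corner : Cell n
      corner = cell c (fromℕ< b<1+c)
  ... | inj₂ a≡c = colIncr (cell a b) (cell c d) a≡c
                     (ℕ.≤∧≢⇒< b≤d λ b≡d → ≢ (cong point (cell-≡ a≡c b≡d)))

  pos : F2 n → Fin (suc (tri n))
  pos ∅        = zero
  pos (pt a b) = suc (entry (cell a b))

  pos-injective : ∀ {x y} → pos x ≡ pos y → x ≡ y
  pos-injective {∅}      {∅}      _  = refl
  pos-injective {pt a b} {pt c d} eq = cong point (proj₁ bijective (suc-injective eq))

  pos-surjective : ∀ i → ∃ λ x → ∀ {z} → z ≡ x → pos z ≡ i
  pos-surjective zero = ∅ , λ { refl → refl }
  pos-surjective (suc i) with proj₂ bijective i
  ... | cell c r , entry≡ = pt c r , λ { refl → cong suc (entry≡ refl) }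

  pos-extends : ∀ {x y} → x ≺ y → pos x <ᶠ pos y
  pos-extends {∅}      {∅}      (_ , ≢)   = ⊥-elim (≢ refl)
  pos-extends {∅}      {pt c d} _         = s≤s z≤n
  pos-extends {pt a b} {pt c d} ab≺cd     = s≤s (entry-mono {cell a b} {cell c d} ab≺cd)

  linExt : LinExt n
  linExt = record { pos = pos ; bijective = pos-injective , pos-surjective ; extends = pos-extends }

mainTheorem1 : (n : ℕ) → n ≥ 1 → Inverse (LinExtSetoid n) (ShiftedSYTSetoid n)
mainTheorem1 n _ = record
  { to        = FromLinExt.shiftedSYT
  ; from      = FromShiftedSYT.linExt
  ; to-cong   = λ { L≈M (cell c r) → punchOut-cong zero (L≈M (pt c r)) }
  ; from-cong = λ { S≈T ∅ → refl ; S≈T (pt a b) → cong suc (S≈T (cell a b)) }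
  ; inverse   = (λ { L≈S (cell c r) → punchOut-cong zero {i≢k = λ ()} (L≈S (pt c r)) })
              , (λ { {L} S≈L ∅ → sym (FromLinExt.pos-∅ L)
                   ; {L} S≈L (pt a b) →
                       trans (cong suc (S≈L (cell a b))) (punchIn-punchOut (FromLinExt.zero≢pos L (cell a b))) })
  }
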